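{- Let $\alpha\subset\beta\subset\delta$ be stable shapes with $\beta/\alpha$ a stable horizontal strip and $\delta/\beta$ a single box. Let $c$ be the column of the box $\delta/\beta$ and $H$ the set of columns containing boxes of $\beta/\alpha$. Define the stable shape $\gamma$ covering $\alpha$ as follows: if $c\in H$, $\gamma/\alpha$ is the box of column $c$ (addable to $\alpha$); if $c\notin H$, let $c'$ be the smallest element of $H$ greater than $c$ and let $\gamma/\alpha$ be the box of column $c'$. Then $\gamma\subset\delta$, $\delta/\gamma$ is a stable horizontal strip, and hopscotch applied to the one-box tableau $P=\delta/\beta$ and the stable horizontal strip $Q=\beta/\alpha$ gives $\mathcal{H}(P;Q)=(T;U)$ with $T$ the one-box tableau $\gamma/\alpha$ and $U$ the stable horizontal strip $\delta/\gamma$; i.e. $\gamma=\mathcal{H}(\alpha,\beta,\delta)$.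
   Context: Stable shapes are finite weakly decreasing sequences of integers and symbols $\infty,\bar\infty$ ($\bar\infty<n<\infty$), with arbitrarily many trailing $\bar\infty$ understood, ordered componentwise; a box of a skew shape $\beta/\alpha$ lies in row $i$, column $j$ with $\alpha_i<j\leq\beta_i$. A stable horizontal strip is a pair $\alpha\subseteq\beta$ such that with $\alpha_m$ the first finite part of $\alpha$ and $\beta_n$ the last finite part of $\beta$, $\alpha_{m-1}=\infty=\beta_m>\alpha_m\geq\beta_{m+1}\geq\cdots\geq\alpha_{n-1}\geq\beta_n>\alpha_n=\bar\infty=\beta_{n+1}$ (at most one box per column, with two half-infinite rows at either end). Stable tableaux are chains of stable shapes with stable horizontal strip differences; ordinary tableaux are chains of integer shapes with (ordinary) horizontal strip differences ($\beta_i\geq\alpha_i\geq\beta_{i+1}$). The stable complement of $T:\beta^0\subseteq\cdots\subseteq\beta^k$ is $T^S:\beta^k\subseteq(\infty,\beta^{k-1})\subseteq\cdots\subseteq(\infty^k,\beta^0)$, with $(\infty^i,\gamma)$ denoting $\gamma$ with $i$ parts $\infty$ prepended; tableaux differing by vertical shift are identified. Internal column insertion $\mathcal{C}$ is the operation on pairs of tableaux sharing an inner (resp. outer) border computed by writing them along the first row and first column (resp. last row and last column) of a growth diagram and filling in with the local rule $\delta=\mathcal{C}(\alpha;\beta,\gamma)$: $d_m=0$; for $i=m,\dots,2$: $\delta_i=\min\{\beta_i+\gamma_i+d_i-\alpha_i,\alpha_{i-1}\}$, $d_{i-1}=\max\{\beta_i+\gamma_i+d_i-\alpha_i-\alpha_{i-1},0\}$;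 $\delta_1=\beta_1+\gamma_1+d_1-\alpha_1$ (resp. its unique inverse), returning the opposite row and column. Hopscotch: for a tableau $P$ and a stable tableau $Q$, one extending the other, $\mathcal{H}(P;Q):=(T;U^S)$ where $\mathcal{C}(P,Q^S)=(T,U)$. -}

module Defs where

open import Data.Nat using (ℕ; zero; suc) renaming (_<_ to _<ℕ_; _≤_ to _≤ℕ_)
open import Data.Integer as ℤ using (ℤ; +_; -_; _+_; _-_; _⊓_; _⊔_; 0ℤ; 1ℤ)
open import Data.List using (List; []; _∷_; reverse; length)
open import Data.Product using (Σ; _×_; _,_; ∃)
open import Relation.Binary.PropositionalEquality using (_≡_; _≢_)
open import Relation.Nullary using (¬_)

-- Extended integers  ∞̄ < n < ∞   (written -∞ and +∞)

data ℤ∞ : Set where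
  -∞  : ℤ∞
  fin : ℤ → ℤ∞
  +∞  : ℤ∞

infix 4 _≤∞_ _<∞_

data _≤∞_ : ℤ∞ → ℤ∞ → Set where
  -∞≤   : ∀ {x} → -∞ ≤∞ x
  ≤+∞   : ∀ {x} → x ≤∞ +∞
  fin≤  : ∀ {m n} → m ℤ.≤ n → fin m ≤∞ fin n

data _<∞_ : ℤ∞ → ℤ∞ → Set where
  -∞<fin : ∀ {n} → -∞ <∞ fin n
  -∞<+∞  : -∞ <∞ +∞
  fin<+∞ : ∀ {n} → fin n <∞ +∞
  fin<   : ∀ {m n} → m ℤ.< n → fin m <∞ fin n

IsFin : ℤ∞ → Set
IsFin x = Σ ℤ (λ z → x ≡ fin z)

-- Stable shapes: finite lists of parts (top row first), with
-- arbitrarily many trailing -∞ understood.  Rows are 0-indexed.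

Shape : Set
Shape = List ℤ∞

row : Shape → ℕ → ℤ∞
row []       _       = -∞
row (x ∷ _)  zero    = x
row (_ ∷ xs) (suc i) = row xs i

IsStableShape : Shape → Set
IsStableShape s = ∀ i → row s (suc i) ≤∞ row s i

_⊆_ : Shape → Shape → Set
α ⊆ β = ∀ i → row α i ≤∞ row β i

StableHStrip : Shape → Shape → Set
StableHStrip α β =
  α ⊆ β ×
  Σ ℕ λ m → Σ ℕ λ n →
    m <ℕ n ×
    (∀ i → i <ℕ m → row α i ≡ +∞) ×
    IsFin (row α m) ×
    row β m ≡ +∞ ×
    IsFin (row β n) ×
    (∀ i → n <ℕ i → row β i ≡ -∞) ×
    row α n ≡ -∞ ×
    (∀ i → m ≤ℕ i → i <ℕ n → row β (suc i) ≤∞ row α i)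

OneBox : Shape → Shape → ℤ → Set
OneBox β δ c =
  Σ ℕ λ r →
    row β r ≡ fin (c - 1ℤ) ×
    row δ r ≡ fin c ×
    (∀ i → i ≢ r → row δ i ≡ row β i)

InCols : Shape → Shape → ℤ → Set
InCols α β j = Σ ℕ λ i → (row α i <∞ fin j) × (fin j ≤∞ row β i)

ChosenColumn : Shape → Shape → ℤ → ℤ → Set
ChosenColumn α β c c' =
  (InCols α β c → c' ≡ c) ×
  (¬ InCols α β c →
     InCols α β c' × c ℤ.< c' ×
     (∀ h → InCols α β h → c ℤ.< h → c' ℤ.≤ h))

-- The local rule δ = C(α;β,γ) on integer sequences of equal length m
-- (lists, top row first):
--   d_m = 0; for i = m..2:
--     δ_i = min{β_i+γ_i+d_i-α_i, α_{i-1}},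
--     d_{i-1} = max{β_i+γ_i+d_i-α_i-α_{i-1}, 0};
--   δ_1 = β_1+γ_1+d_1-α_1.

localRule-rev : List ℤ → List ℤ → List ℤ → ℤ → List ℤ
localRule-rev (a ∷ []) (b ∷ _) (g ∷ _) d = (b + g + d - a) ∷ []
localRule-rev (a ∷ a' ∷ as) (b ∷ bs) (g ∷ gs) d =
  ((b + g + d - a) ⊓ a') ∷
  localRule-rev (a' ∷ as) bs gs (((b + g + d - a) - a') ⊔ 0ℤ)
localRule-rev _ _ _ _ = []

localRuleℤ : List ℤ → List ℤ → List ℤ → List ℤ
localRuleℤ α β γ =
  reverse (localRule-rev (reverse α) (reverse β) (reverse γ) 0ℤ)

-- Stable shapes are evaluated at truncation level (N , L):
-- the first L rows, with ∞ read as N and ∞̄ read as -N.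
-- The stable local rule is the integer rule on these truncations,
-- for N and L sufficiently large.

truncℤ∞ : ℕ → ℤ∞ → ℤ
truncℤ∞ N -∞      = - (+ N)
truncℤ∞ N (fin z) = z
truncℤ∞ N +∞      = + N

trunc : ℕ → ℕ → Shape → List ℤ
trunc N zero    s = []
trunc N (suc L) s = truncℤ∞ N (row s 0) ∷ trunc N L (tail s)
  where
  tail : Shape → Shape
  tail []       = []
  tail (_ ∷ xs) = xs

stableC : ℕ → ℕ → Shape → Shape → Shape → List ℤ
stableC N L α β γ = localRuleℤ (trunc N L α) (trunc N L β) (trunc N L γ)

-- Hopscotch of the one-box tableau P : β ⊆ δ and the one-step stable
-- tableau Q : α ⊆ β.  Q^S : β ⊆ (∞,α); C(P,Q^S) is one growth-diagram
-- square with corner β and neighbours δ, (∞,α), whose opposite corner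
-- ε = C(β; δ, (∞,α)) gives T : (∞,α) ⊆ ε and U : δ ⊆ ε, hence
-- U^S : ε ⊆ (∞,δ).  We return ε (at truncation level (N , L)).
hopscotchCorner : ℕ → ℕ → Shape → Shape → Shape → List ℤ
hopscotchCorner N L α β δ = stableC N L β δ (+∞ ∷ α)

-- Let k be the lowest row strictly above the new box that contains a box of β/α.
-- The rows between k and the new box are full (α_j = β_j), so in the growth-diagram
-- square C(β; δ, (∞,α)) the surplus box travels up through them as a carry of 1 and
-- is absorbed in row k, where α_k < β_k leaves room for it.  Hence the opposite
-- corner is (∞, γ) with γ = α plus a box in row k, column α_k + 1.  Interlacing puts
-- no column of H in [c, α_k] while α_k + 1 ∈ H, so this column is the least element
-- of H that is ≥ c, which is the column prescribed by the theorem.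
module Submission where

open import Defs
open import Data.Nat using (ℕ; _≤_)
open import Data.Integer using (ℤ)
open import Data.List using (_∷_)
open import Data.Product using (Σ; _×_)
open import Relation.Binary.PropositionalEquality using (_≡_)

open import Data.Bool using (if_then_else_)
open import Data.Empty using (⊥-elim)
open import Data.Integer
  using (+_; -_; _+_; _-_; _⊓_; _⊔_; 0ℤ; 1ℤ; ∣_∣; -[1+_]) renaming (suc to sucℤ)
import Data.Integer as ℤ
open import Data.Integer.Base using (+≤+)
import Data.Integer.Properties as ℤₚ
open import Data.Integer.Tactic.RingSolver using (solve-∀)
open import Data.List using ([]; applyUpTo; applyDownFrom)
open import Data.List.Properties using (reverse-applyUpTo; reverse-applyDownFrom)
open import Data.Nat
  using (zero; suc; _<_; z≤n; s≤s; _≤?_; _<?_; _≟_; _≤′_; ≤′-refl; ≤′-step)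
import Data.Nat as ℕ
import Data.Nat.Properties as ℕₚ
open import Data.Product using (_,_; proj₁; proj₂)
open import Data.Sum using (inj₁; inj₂)
open import Function using (_∘_)
open import Relation.Binary.Definitions using (tri<; tri≈; tri>)
open import Relation.Binary.PropositionalEquality
  using (_≢_; refl; sym; trans; cong; cong₂; subst; subst₂)
open import Relation.Nullary using (¬_; Dec; yes; no; does; ¬?)
open import Relation.Nullary.Decidable using (_×-dec_; dec-true; dec-false; decidable-stable)
open import Relation.Unary using (Decidable)

-- Extended integers

≤∞-refl : ∀ {x} → x ≤∞ x
≤∞-refl { -∞}   = -∞≤
≤∞-refl {fin _} = fin≤ ℤₚ.≤-refl
≤∞-refl {+∞}    = ≤+∞

≤∞-reflexive : ∀ {x y} → x ≡ y → x ≤∞ y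
≤∞-reflexive refl = ≤∞-refl

≤∞-trans : ∀ {x y z} → x ≤∞ y → y ≤∞ z → x ≤∞ z
≤∞-trans -∞≤      _        = -∞≤
≤∞-trans ≤+∞      ≤+∞      = ≤+∞
≤∞-trans (fin≤ _) ≤+∞      = ≤+∞
≤∞-trans (fin≤ p) (fin≤ q) = fin≤ (ℤₚ.≤-trans p q)

<∞-≤∞-trans : ∀ {x y z} → x <∞ y → y ≤∞ z → x <∞ z
<∞-≤∞-trans -∞<fin   ≤+∞      = -∞<+∞
<∞-≤∞-trans -∞<fin   (fin≤ _) = -∞<fin
<∞-≤∞-trans -∞<+∞    ≤+∞      = -∞<+∞
<∞-≤∞-trans fin<+∞   ≤+∞      = fin<+∞
<∞-≤∞-trans (fin< _) ≤+∞      = fin<+∞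
<∞-≤∞-trans (fin< p) (fin≤ q) = fin< (ℤₚ.<-≤-trans p q)

≤∞-<∞-trans : ∀ {x y z} → x ≤∞ y → y <∞ z → x <∞ z
≤∞-<∞-trans -∞≤      -∞<fin   = -∞<fin
≤∞-<∞-trans -∞≤      -∞<+∞    = -∞<+∞
≤∞-<∞-trans -∞≤      fin<+∞   = -∞<+∞
≤∞-<∞-trans -∞≤      (fin< _) = -∞<fin
≤∞-<∞-trans ≤+∞      ()
≤∞-<∞-trans (fin≤ _) fin<+∞   = fin<+∞
≤∞-<∞-trans (fin≤ p) (fin< q) = fin< (ℤₚ.≤-<-trans p q)

<∞-irrefl : ∀ {x} → ¬ (x <∞ x)
<∞-irrefl (fin< p) = ℤₚ.<-irrefl refl p

<∞⇒≢+∞ : ∀ {x y} → x <∞ y → x ≢ +∞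
<∞⇒≢+∞ () refl

fin≤⁻¹ : ∀ {a b} → fin a ≤∞ fin b → a ℤ.≤ b
fin≤⁻¹ (fin≤ p) = p

fin<⁻¹ : ∀ {a b} → fin a <∞ fin b → a ℤ.< b
fin<⁻¹ (fin< p) = p

fin≢+∞ : ∀ {z} → fin z ≢ +∞
fin≢+∞ ()

fin≢-∞ : ∀ {z} → fin z ≢ -∞
fin≢-∞ ()

fin-injective : ∀ {a b} → fin a ≡ fin b → a ≡ b
fin-injective refl = refl

+∞≤∞⇒≡+∞ : ∀ {x} → +∞ ≤∞ x → x ≡ +∞
+∞≤∞⇒≡+∞ ≤+∞ = refl

≤∞∧≢⇒<∞ : ∀ {x y} → x ≤∞ y → x ≢ y → x <∞ y
≤∞∧≢⇒<∞ { -∞} { -∞}   _        x≢y = ⊥-elim (x≢y refl)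
≤∞∧≢⇒<∞ { -∞} {fin _} _        _   = -∞<fin
≤∞∧≢⇒<∞ { -∞} {+∞}    _        _   = -∞<+∞
≤∞∧≢⇒<∞ {fin _} ≤+∞            _   = fin<+∞
≤∞∧≢⇒<∞ {fin _} (fin≤ p)       x≢y = fin< (ℤₚ.≤∧≢⇒< p (x≢y ∘ cong fin))
≤∞∧≢⇒<∞ {+∞}    ≤+∞            x≢y = ⊥-elim (x≢y refl)

fin<∞⇒fin-suc≤∞ : ∀ {a y} → fin a <∞ y → fin (sucℤ a) ≤∞ y
fin<∞⇒fin-suc≤∞ fin<+∞   = ≤+∞
fin<∞⇒fin-suc≤∞ (fin< p) = fin≤ (ℤₚ.i<j⇒suc[i]≤j p)

fin≤∞≤fin⇒IsFin : ∀ {a b x} → fin a ≤∞ x → x ≤∞ fin b → IsFin x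
fin≤∞≤fin⇒IsFin {x = fin z} _ _ = z , refl

_≟∞_ : (x y : ℤ∞) → Dec (x ≡ y)
-∞    ≟∞ -∞    = yes refl
-∞    ≟∞ fin _ = no (λ ())
-∞    ≟∞ +∞    = no (λ ())
fin _ ≟∞ -∞    = no (λ ())
fin a ≟∞ fin b with a ℤₚ.≟ b
... | yes refl = yes refl
... | no a≢b   = no (a≢b ∘ fin-injective)
fin _ ≟∞ +∞    = no (λ ())
+∞    ≟∞ -∞    = no (λ ())
+∞    ≟∞ fin _ = no (λ ())
+∞    ≟∞ +∞    = yes refl

sucℤ∞ : ℤ∞ → ℤ∞
sucℤ∞ (fin z) = fin (sucℤ z)
sucℤ∞ x       = x

x≤∞sucℤ∞x : ∀ x → x ≤∞ sucℤ∞ x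
x≤∞sucℤ∞x -∞      = -∞≤
x≤∞sucℤ∞x (fin z) = fin≤ (ℤₚ.i≤suc[i] z)
x≤∞sucℤ∞x +∞      = ≤+∞

sucℤ[i-1]≡i : ∀ i → sucℤ (i - 1ℤ) ≡ i
sucℤ[i-1]≡i = 1+[i-1]≡i
  where
  1+[i-1]≡i : ∀ i → 1ℤ + (i - 1ℤ) ≡ i
  1+[i-1]≡i = solve-∀

i-1<i : ∀ i → i - 1ℤ ℤ.< i
i-1<i i = ℤₚ.suc[i]≤j⇒i<j (ℤₚ.≤-reflexive (sucℤ[i-1]≡i i))

-∣i∣≤i≤∣i∣ : ∀ i → - (+ ∣ i ∣) ℤ.≤ i × i ℤ.≤ + ∣ i ∣
-∣i∣≤i≤∣i∣ (+ n)    = ℤₚ.neg-≤-pos , ℤₚ.≤-refl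
-∣i∣≤i≤∣i∣ -[1+ n ] = ℤₚ.≤-refl , ℤ.-≤+

-- Shapes

row-antitone : ∀ s → IsStableShape s → ∀ {i j} → i ≤ j → row s j ≤∞ row s i
row-antitone s st i≤j = go (ℕₚ.≤⇒≤′ i≤j)
  where
  go : ∀ {i j} → i ≤′ j → row s j ≤∞ row s i
  go ≤′-refl     = ≤∞-refl
  go (≤′-step p) = ≤∞-trans (st _) (go p)

addBox : Shape → ℕ → Shape
addBox []       _       = []
addBox (x ∷ xs) zero    = sucℤ∞ x ∷ xs
addBox (x ∷ xs) (suc k) = x ∷ addBox xs k

row-addBox-≡ : ∀ s k → row (addBox s k) k ≡ sucℤ∞ (row s k)
row-addBox-≡ []       _       = refl
row-addBox-≡ (_ ∷ xs) zero    = refl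
row-addBox-≡ (_ ∷ xs) (suc k) = row-addBox-≡ xs k

row-addBox-≢ : ∀ s {k i} → i ≢ k → row (addBox s k) i ≡ row s i
row-addBox-≢ []       _                 = refl
row-addBox-≢ (_ ∷ xs) {zero}  {zero}  i≢k = ⊥-elim (i≢k refl)
row-addBox-≢ (_ ∷ xs) {zero}  {suc i} _   = refl
row-addBox-≢ (_ ∷ xs) {suc k} {zero}  _   = refl
row-addBox-≢ (_ ∷ xs) {suc k} {suc i} i≢k = row-addBox-≢ xs (i≢k ∘ cong suc)

addBox-⊆ : ∀ s k → s ⊆ addBox s k
addBox-⊆ s k i with i ≟ k
... | yes refl = subst (row s i ≤∞_) (sym (row-addBox-≡ s i)) (x≤∞sucℤ∞x (row s i))
... | no i≢k   = ≤∞-reflexive (sym (row-addBox-≢ s i≢k))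

addBox-stable : ∀ s k → IsStableShape s →
  (∀ {i} → suc i ≡ k → sucℤ∞ (row s k) ≤∞ row s i) → IsStableShape (addBox s k)
addBox-stable s k st fits i with i ≟ k | suc i ≟ k
... | yes refl | _ = subst (_≤∞ row (addBox s i) i) (sym (row-addBox-≢ s ℕₚ.1+n≢n))
                       (≤∞-trans (st i) (addBox-⊆ s i i))
... | no i≢k | yes refl = subst₂ _≤∞_ (sym (row-addBox-≡ s (suc i))) (sym (row-addBox-≢ s i≢k))
                            (fits refl)
... | no i≢k | no 1+i≢k = subst₂ _≤∞_ (sym (row-addBox-≢ s 1+i≢k)) (sym (row-addBox-≢ s i≢k)) (st i)

addBox-oneBox : ∀ s k {z} → row s k ≡ fin z → OneBox s (addBox s k) (sucℤ z)
addBox-oneBox s k {z} sk =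
  k , trans sk (cong fin (sym ([1+i]-1≡i z))) , trans (row-addBox-≡ s k) (cong sucℤ∞ sk)
    , λ i → row-addBox-≢ s
  where
  [1+i]-1≡i : ∀ i → 1ℤ + i - 1ℤ ≡ i
  [1+i]-1≡i = solve-∀

oneBox⇒⊆ : ∀ β δ {c} → OneBox β δ c → β ⊆ δ
oneBox⇒⊆ _ _ {c} (r , βr , δr , others) i with i ≟ r
... | yes refl = subst₂ _≤∞_ (sym βr) (sym δr) (fin≤ (ℤₚ.<⇒≤ (i-1<i c)))
... | no i≢r   = ≤∞-reflexive (sym (others i i≢r))

oneBox-IsFin : ∀ β δ {c i} → OneBox β δ c → IsFin (row β i) → IsFin (row δ i)
oneBox-IsFin _ _ {c} {i} (r , _ , δr , others) (z , βi) with i ≟ r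
... | yes refl = c , δr
... | no i≢r   = z , trans (others i i≢r) βi

oneBox-fixes-infinite : ∀ β δ {c i x} → OneBox β δ c → row β i ≡ x → ¬ IsFin x → row δ i ≡ x
oneBox-fixes-infinite _ _ {c} {i} (r , βr , _ , others) βi x-infinite with i ≟ r
... | yes refl = ⊥-elim (x-infinite (c - 1ℤ , trans (sym βi) βr))
... | no i≢r   = trans (others i i≢r) βi

+∞-infinite : ¬ IsFin +∞
+∞-infinite (_ , ())

-∞-infinite : ¬ IsFin -∞
-∞-infinite (_ , ())

hstrip-top : ∀ α β {m} → α ⊆ β → (∀ i → i < m → row α i ≡ +∞) → row β m ≡ +∞ →
  ∀ {i} → i ≤ m → row β i ≡ +∞
hstrip-top α β α⊆β α-top βm {i} i≤m with ℕₚ.m≤n⇒m<n∨m≡n i≤m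
... | inj₁ i<m  = +∞≤∞⇒≡+∞ (subst (_≤∞ row β i) (α-top i i<m) (α⊆β i))
... | inj₂ refl = βm

least≥⇒chosenColumn : ∀ α β {c c'} → InCols α β c' → c ℤ.≤ c' →
  (∀ h → InCols α β h → c ℤ.≤ h → c' ℤ.≤ h) → ChosenColumn α β c c'
least≥⇒chosenColumn _ _ c'∈H c≤c' least =
  (λ c∈H → ℤₚ.≤-antisym (least _ c∈H ℤₚ.≤-refl) c≤c') ,
  (λ c∉H → c'∈H , ℤₚ.≤∧≢⇒< c≤c' (λ { refl → c∉H c'∈H })
         , λ h h∈H c<h → least h h∈H (ℤₚ.<⇒≤ c<h))

record GreatestWitness (P : ℕ → Set) (m s : ℕ) : Set where
  field
    index       : ℕ
    m≤index     : m ≤ index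
    index≤s     : index ≤ s
    holds       : P index
    fails-above : ∀ {j} → index < j → j ≤ s → ¬ P j

greatestWitness : ∀ {P} → Decidable P → ∀ {m s} → m ≤ s → P m → GreatestWitness P m s
greatestWitness P? {s = s} m≤s Pm with P? s
... | yes Ps = record
  { index = s ; m≤index = m≤s ; index≤s = ℕₚ.≤-refl ; holds = Ps
  ; fails-above = λ s<j j≤s → ⊥-elim (ℕₚ.<⇒≱ s<j j≤s) }
greatestWitness {P} P? {m} {suc s} m≤1+s Pm | no ¬P1+s = record
  { GreatestWitness below
  ; index≤s     = ℕₚ.m≤n⇒m≤1+n index≤s
  ; fails-above = fails-above′ }
  where
  below : GreatestWitness P m s
  below = greatestWitness P? (ℕₚ.≤-pred (ℕₚ.≤∧≢⇒< m≤1+s λ { refl → ¬P1+s Pm })) Pm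
  open GreatestWitness below
  fails-above′ : ∀ {j} → index < j → j ≤ suc s → ¬ P j
  fails-above′ i<j j≤1+s with ℕₚ.m≤n⇒m<n∨m≡n j≤1+s
  ... | inj₁ j<1+s = fails-above i<j (ℕₚ.≤-pred j<1+s)
  ... | inj₂ refl  = ¬P1+s
greatestWitness P? {s = zero} z≤n Pm | no ¬P0 = ⊥-elim (¬P0 Pm)

-- The integer local rule

-- A, B, G, E read the rows of α, β, γ, δ = C(α; β, γ) from the top, and D j is the
-- carry d that row j + 1 hands up to row j.
record SolvesLocalRule (A B G E D : ℕ → ℤ) : Set where
  field
    top  : E 0 ≡ B 0 + G 0 + D 0 - A 0
    step : ∀ j → let x = B (suc j) + G (suc j) + D (suc j) - A (suc j) in
           E (suc j) ≡ x ⊓ A j × D j ≡ (x - A j) ⊔ 0ℤ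

module _ {A B G E D : ℕ → ℤ} (sol : SolvesLocalRule A B G E D) where
  open SolvesLocalRule sol

  localRule-rev-applyDownFrom : ∀ L →
    localRule-rev (applyDownFrom A (suc L)) (applyDownFrom B (suc L)) (applyDownFrom G (suc L)) (D L)
      ≡ applyDownFrom E (suc L)
  localRule-rev-applyDownFrom zero    = cong (_∷ []) (sym top)
  localRule-rev-applyDownFrom (suc L) =
    cong₂ _∷_ (sym (proj₁ (step L)))
      (subst (λ d → localRule-rev (applyDownFrom A (suc L)) (applyDownFrom B (suc L))
                                  (applyDownFrom G (suc L)) d ≡ applyDownFrom E (suc L))
             (proj₂ (step L)) (localRule-rev-applyDownFrom L))

  localRuleℤ-applyUpTo : ∀ L → D L ≡ 0ℤ →
    localRuleℤ (applyUpTo A (suc L)) (applyUpTo B (suc L)) (applyUpTo G (suc L)) ≡ applyUpTo E (suc L)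
  localRuleℤ-applyUpTo L DL≡0
    rewrite reverse-applyUpTo A (suc L) | reverse-applyUpTo B (suc L) | reverse-applyUpTo G (suc L)
          | sym DL≡0
          | localRule-rev-applyDownFrom L = reverse-applyDownFrom E (suc L)

-- Intended reading: A = β, B = β plus a box in row r, G = (∞, α) with β/α a horizontal
-- strip, and E = (∞, γ) with γ = α plus a box in row k.
module BoxSlide (A B G E : ℕ → ℤ) {k r : ℕ} (k<r : k < r)
  (G≤A   : ∀ j → G (suc j) ℤ.≤ A j)
  (slack : G (suc k) ℤ.< A k)
  (tight : ∀ {j} → k < j → j < r → G (suc j) ≡ A j)
  (B-box : B r ≡ sucℤ (A r)) (B-other : ∀ {i} → i ≢ r → B i ≡ A i)
  (E-top : E 0 ≡ G 0) (E-box : E (suc k) ≡ sucℤ (G (suc k)))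
  (E-other : ∀ {j} → j ≢ k → E (suc j) ≡ G (suc j)) where

  carry : ℕ → ℤ
  carry i = if does ((k <? i) ×-dec (i <? r)) then 1ℤ else 0ℤ

  carry-inside : ∀ {i} → k < i → i < r → carry i ≡ 1ℤ
  carry-inside {i} k<i i<r rewrite dec-true ((k <? i) ×-dec (i <? r)) (k<i , i<r) = refl

  carry-outside : ∀ {i} → ¬ (k < i × i < r) → carry i ≡ 0ℤ
  carry-outside {i} out rewrite dec-false ((k <? i) ×-dec (i <? r)) out = refl

  inflow : ℕ → ℤ
  inflow j = B (suc j) + G (suc j) + carry (suc j) - A (suc j)

  inflow-≡ : ∀ {j} b {d} → B (suc j) ≡ b + A (suc j) → carry (suc j) ≡ d →
    inflow j ≡ (b + d) + G (suc j)
  inflow-≡ {j} b {d} Bj cj rewrite Bj | cj = cancel (A (suc j)) b d (G (suc j))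
    where
    cancel : ∀ a b d g → b + a + g + d - a ≡ (b + d) + g
    cancel = solve-∀

  inflow-quiet : ∀ {j} → suc j ≢ r → ¬ (k < suc j × suc j < r) → inflow j ≡ G (suc j)
  inflow-quiet {j} 1+j≢r out =
    trans (inflow-≡ 0ℤ (trans (B-other 1+j≢r) (sym (ℤₚ.+-identityˡ _))) (carry-outside out))
          (ℤₚ.+-identityˡ _)

  inflow-box : ∀ {j} → k ≤ j → j < r → inflow j ≡ sucℤ (G (suc j))
  inflow-box {j} k≤j j<r with suc j ≟ r
  ... | yes refl = inflow-≡ 1ℤ B-box (carry-outside (ℕₚ.<-irrefl refl ∘ proj₂))
  ... | no 1+j≢r = inflow-≡ 0ℤ (trans (B-other 1+j≢r) (sym (ℤₚ.+-identityˡ _)))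
                            (carry-inside (s≤s k≤j) (ℕₚ.≤∧≢⇒< j<r 1+j≢r))

  Step : ℕ → Set
  Step j = E (suc j) ≡ inflow j ⊓ A j × carry j ≡ (inflow j - A j) ⊔ 0ℤ

  settle : ∀ {j x} → inflow j ≡ x → x ℤ.≤ A j → E (suc j) ≡ x → carry j ≡ 0ℤ → Step j
  settle refl x≤a Ej cj =
    trans Ej (sym (ℤₚ.i≤j⇒i⊓j≡i x≤a)) ,
    trans cj (sym (ℤₚ.i≤j⇒i⊔j≡j (ℤₚ.i≤j⇒i-j≤0 x≤a)))

  pass : ∀ {j} → inflow j ≡ sucℤ (A j) → E (suc j) ≡ A j → carry j ≡ 1ℤ → Step j
  pass {j} x≡1+a Ej cj rewrite x≡1+a =
    trans Ej (sym (ℤₚ.i≥j⇒i⊓j≡j (ℤₚ.i≤suc[i] (A j)))) ,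
    trans cj (cong (_⊔ 0ℤ) (sym (1+a-a≡1 (A j))))
    where
    1+a-a≡1 : ∀ a → 1ℤ + a - a ≡ 1ℤ
    1+a-a≡1 = solve-∀

  step : ∀ j → Step j
  step j with ℕₚ.<-cmp j k
  ... | tri< j<k _ _ =
    settle (inflow-quiet (ℕₚ.<⇒≢ (ℕₚ.≤-<-trans j<k k<r)) (ℕₚ.<⇒≱ j<k ∘ ℕₚ.≤-pred ∘ proj₁))
           (G≤A j) (E-other (ℕₚ.<⇒≢ j<k)) (carry-outside (ℕₚ.<-asym j<k ∘ proj₁))
  ... | tri≈ _ refl _ =
    settle (inflow-box ℕₚ.≤-refl k<r) (ℤₚ.i<j⇒suc[i]≤j slack) E-box
           (carry-outside (ℕₚ.<-irrefl refl ∘ proj₁))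
  ... | tri> _ _ k<j with j <? r
  ...   | yes j<r =
    pass (trans (inflow-box (ℕₚ.<⇒≤ k<j) j<r) (cong sucℤ (tight k<j j<r)))
         (trans (E-other (ℕₚ.>⇒≢ k<j)) (tight k<j j<r)) (carry-inside k<j j<r)
  ...   | no j≮r =
    settle (inflow-quiet (j≮r ∘ ℕₚ.≤-reflexive) (j≮r ∘ ℕₚ.<-trans (ℕₚ.n<1+n j) ∘ proj₂))
           (G≤A j) (E-other (ℕₚ.>⇒≢ k<j)) (carry-outside (j≮r ∘ proj₂))

  solves : SolvesLocalRule A B G E carry
  solves = record { top = top ; step = step }
    where
    top : E 0 ≡ B 0 + G 0 + carry 0 - A 0
    top = trans E-top (trans (sym (cancel (A 0) (G 0)))
            (cong₂ (λ b d → b + G 0 + d - A 0)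
                   (sym (B-other (ℕₚ.<⇒≢ (ℕₚ.≤-<-trans z≤n k<r))))
                   (sym (carry-outside {0} (λ ())))))
      where
      cancel : ∀ a g → a + g + 0ℤ - a ≡ g
      cancel = solve-∀

  localRuleℤ-boxSlide : ∀ L → r < L →
    localRuleℤ (applyUpTo A L) (applyUpTo B L) (applyUpTo G L) ≡ applyUpTo E L
  localRuleℤ-boxSlide (suc L) (s≤s r≤L) =
    localRuleℤ-applyUpTo solves L (carry-outside (λ (_ , L<r) → ℕₚ.<⇒≱ L<r r≤L))

-- Truncation

trunc-applyUpTo : ∀ N L s → trunc N L s ≡ applyUpTo (truncℤ∞ N ∘ row s) L
trunc-applyUpTo N zero    _        = refl
trunc-applyUpTo N (suc L) []       = cong (_ ∷_) (trunc-applyUpTo N L [])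
trunc-applyUpTo N (suc L) (_ ∷ xs) = cong (_ ∷_) (trunc-applyUpTo N L xs)

truncℤ∞-mono : ∀ {N x y} → x ≤∞ y → - (+ N) ℤ.≤ truncℤ∞ N y → truncℤ∞ N x ℤ.≤ + N →
  truncℤ∞ N x ℤ.≤ truncℤ∞ N y
truncℤ∞-mono -∞≤      -N≤y _   = -N≤y
truncℤ∞-mono ≤+∞      _    x≤N = x≤N
truncℤ∞-mono (fin≤ p) _    _   = p

truncℤ∞-lower : ∀ {N x} → (∀ {z} → x ≡ fin z → - (+ N) ℤ.≤ z) → - (+ N) ℤ.≤ truncℤ∞ N x
truncℤ∞-lower {x = -∞}    _   = ℤₚ.≤-refl
truncℤ∞-lower {x = fin _} bound = bound refl
truncℤ∞-lower {x = +∞}    _   = ℤₚ.neg-≤-pos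

truncℤ∞-upper : ∀ {N x} → (∀ {z} → x ≡ fin z → z ℤ.≤ + N) → truncℤ∞ N x ℤ.≤ + N
truncℤ∞-upper {x = -∞}    _   = ℤₚ.neg-≤-pos
truncℤ∞-upper {x = fin _} bound = bound refl
truncℤ∞-upper {x = +∞}    _   = ℤₚ.≤-refl

-- Hopscotch of a single box against a stable horizontal strip

module OneBoxHopscotch
  {α β δ : Shape} {c am bn : ℤ} {m n r : ℕ}
  (stα : IsStableShape α) (stβ : IsStableShape β) (stδ : IsStableShape δ)
  (α⊆β : α ⊆ β)
  (α-top : ∀ i → i < m → row α i ≡ +∞) (αm≡ : row α m ≡ fin am) (βm≡ : row β m ≡ +∞)
  (βn≡ : row β n ≡ fin bn) (β-bottom : ∀ i → n < i → row β i ≡ -∞) (αn≡ : row α n ≡ -∞)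
  (interlace : ∀ i → m ≤ i → i < n → row β (suc i) ≤∞ row α i)
  (βbox≡ : row β (suc r) ≡ fin (c - 1ℤ)) (δbox≡ : row δ (suc r) ≡ fin c)
  (δ-other : ∀ i → i ≢ suc r → row δ i ≡ row β i) where

  δ-oneBox : OneBox β δ c
  δ-oneBox = suc r , βbox≡ , δbox≡ , δ-other

  α<∞⇒m≤ : ∀ {i x} → row α i <∞ x → m ≤ i
  α<∞⇒m≤ {i} αi<x = ℕₚ.≮⇒≥ (λ i<m → <∞⇒≢+∞ αi<x (α-top i i<m))

  β-finite⇒m< : ∀ {i z} → row β i ≡ fin z → m < i
  β-finite⇒m< βi = ℕₚ.≰⇒> (λ i≤m → fin≢+∞ (trans (sym βi) (hstrip-top α β α⊆β α-top βm≡ i≤m)))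

  β-finite⇒≤n : ∀ {i z} → row β i ≡ fin z → i ≤ n
  β-finite⇒≤n {i} βi = ℕₚ.≮⇒≥ (λ n<i → fin≢-∞ (trans (sym βi) (β-bottom i n<i)))

  α-finite-≤ : ∀ {i z} → row α i ≡ fin z → z ℤ.≤ am
  α-finite-≤ αi = fin≤⁻¹ (subst₂ _≤∞_ αi αm≡
    (row-antitone α stα (α<∞⇒m≤ (subst (_<∞ +∞) (sym αi) fin<+∞))))

  β-finite-≥ : ∀ {i z} → row β i ≡ fin z → bn ℤ.≤ z
  β-finite-≥ βi = fin≤⁻¹ (subst₂ _≤∞_ βn≡ βi (row-antitone β stβ (β-finite⇒≤n βi)))

  β≤α : ∀ {i j} → m ≤ i → i < n → i < j → row β j ≤∞ row α i
  β≤α {i} m≤i i<n i<j = ≤∞-trans (row-antitone β stβ i<j) (interlace i m≤i i<n)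

  m≤r : m ≤ r
  m≤r = ℕₚ.≤-pred (β-finite⇒m< βbox≡)

  r<n : r < n
  r<n = β-finite⇒≤n βbox≡

  c≤βr : fin c ≤∞ row β r
  c≤βr = subst₂ _≤∞_ δbox≡ (δ-other r (ℕₚ.1+n≢n ∘ sym)) (stδ r)

  c-1≤αr : fin (c - 1ℤ) ≤∞ row α r
  c-1≤αr = subst (_≤∞ row α r) βbox≡ (interlace r m≤r r<n)

  slackRow : GreatestWitness (λ j → row α j ≢ row β j) m r
  slackRow = greatestWitness (λ j → ¬? (row α j ≟∞ row β j)) m≤r
    (λ αm≡βm → fin≢+∞ (trans (sym αm≡) (trans αm≡βm βm≡)))

  open GreatestWitness slackRow
    renaming (index to k; m≤index to m≤k; index≤s to k≤r; holds to αk≢βk)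

  full : ∀ {j} → k < j → j ≤ r → row α j ≡ row β j
  full {j} k<j j≤r = decidable-stable (row α j ≟∞ row β j) (fails-above k<j j≤r)

  k<n : k < n
  k<n = ℕₚ.≤-<-trans k≤r r<n

  αk-finite : IsFin (row α k)
  αk-finite = fin≤∞≤fin⇒IsFin (subst (_≤∞ row α k) βn≡ (β≤α m≤k k<n k<n))
                               (subst (row α k ≤∞_) αm≡ (row-antitone α stα m≤k))

  a : ℤ
  a = proj₁ αk-finite

  αk≡ : row α k ≡ fin a
  αk≡ = proj₂ αk-finite

  c' : ℤ
  c' = sucℤ a

  c'≤βk : fin c' ≤∞ row β k
  c'≤βk = fin<∞⇒fin-suc≤∞ (subst (_<∞ row β k) αk≡ (≤∞∧≢⇒<∞ (α⊆β k) αk≢βk))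

  c≤c' : c ℤ.≤ c'
  c≤c' = subst (ℤ._≤ c') (sucℤ[i-1]≡i c) (ℤₚ.suc-mono
           (fin≤⁻¹ (≤∞-trans c-1≤αr (subst (row α r ≤∞_) αk≡ (row-antitone α stα k≤r)))))

  c'∈H : InCols α β c'
  c'∈H = k , subst (_<∞ fin c') (sym αk≡) (fin< (ℤₚ.suc[i]≤j⇒i<j ℤₚ.≤-refl)) , c'≤βk

  c'-least : ∀ h → InCols α β h → c ℤ.≤ h → c' ℤ.≤ h
  c'-least h (i , αi<h , h≤βi) c≤h with ℕₚ.<-cmp i k
  ... | tri< i<k _ _ =
    ℤₚ.<⇒≤ (fin<⁻¹ (≤∞-<∞-trans (≤∞-trans c'≤βk
      (β≤α (α<∞⇒m≤ αi<h) (ℕₚ.<-trans i<k k<n) i<k)) αi<h))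
  ... | tri≈ _ refl _ = ℤₚ.i<j⇒suc[i]≤j (fin<⁻¹ (subst (_<∞ fin h) αk≡ αi<h))
  ... | tri> _ _ k<i with i ≤? r
  ...   | yes i≤r = ⊥-elim (<∞-irrefl (<∞-≤∞-trans αi<h (subst (fin h ≤∞_) (sym (full k<i i≤r)) h≤βi)))
  ...   | no i≰r  = ⊥-elim (ℤₚ.<-irrefl refl (ℤₚ.≤-<-trans h≤c-1 (ℤₚ.<-≤-trans (i-1<i c) c≤h)))
    where
    h≤c-1 : h ℤ.≤ c - 1ℤ
    h≤c-1 = fin≤⁻¹ (≤∞-trans h≤βi (subst (row β i ≤∞_) βbox≡ (row-antitone β stβ (ℕₚ.≰⇒> i≰r))))

  chosen : ChosenColumn α β c c'
  chosen = least≥⇒chosenColumn α β c'∈H c≤c' c'-least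

  γ : Shape
  γ = addBox α k

  γk≡ : row γ k ≡ fin c'
  γk≡ = trans (row-addBox-≡ α k) (cong sucℤ∞ αk≡)

  γ-other : ∀ {i} → i ≢ k → row γ i ≡ row α i
  γ-other = row-addBox-≢ α

  γ-oneBox : OneBox α γ c'
  γ-oneBox = addBox-oneBox α k αk≡

  α⊆γ : α ⊆ γ
  α⊆γ = addBox-⊆ α k

  c'≤α-above : ∀ {i} → i < k → fin c' ≤∞ row α i
  c'≤α-above {i} i<k with m ≤? i
  ... | yes m≤i = ≤∞-trans c'≤βk (β≤α m≤i (ℕₚ.<-trans i<k k<n) i<k)
  ... | no i≱m  = subst (fin c' ≤∞_) (sym (α-top i (ℕₚ.≰⇒> i≱m))) ≤+∞

  γ-stable : IsStableShape γ
  γ-stable = addBox-stable α k stα λ 1+i≡k →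
    subst (_≤∞ _) (cong sucℤ∞ (sym αk≡)) (c'≤α-above (ℕₚ.≤-reflexive 1+i≡k))

  γ⊆δ : γ ⊆ δ
  γ⊆δ i with i ≟ k
  ... | yes refl = subst (_≤∞ row δ i) (sym γk≡) (≤∞-trans c'≤βk (oneBox⇒⊆ β δ δ-oneBox i))
  ... | no i≢k   = subst (_≤∞ row δ i) (sym (γ-other i≢k)) (≤∞-trans (α⊆β i) (oneBox⇒⊆ β δ δ-oneBox i))

  c≤γr : fin c ≤∞ row γ r
  c≤γr with ℕₚ.m≤n⇒m<n∨m≡n k≤r
  ... | inj₁ k<r  = subst (fin c ≤∞_) (sym (trans (γ-other (ℕₚ.>⇒≢ k<r)) (full k<r ℕₚ.≤-refl))) c≤βr
  ... | inj₂ k≡r  = subst (λ i → fin c ≤∞ row γ i) k≡r (subst (fin c ≤∞_) (sym γk≡) (fin≤ c≤c'))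

  γδ-interlace : ∀ i → m ≤ i → i < n → row δ (suc i) ≤∞ row γ i
  γδ-interlace i m≤i i<n with suc i ≟ suc r
  ... | yes refl   = subst (_≤∞ row γ i) (sym δbox≡) c≤γr
  ... | no 1+i≢1+r = subst (_≤∞ row γ i) (sym (δ-other (suc i) 1+i≢1+r))
                       (≤∞-trans (interlace i m≤i i<n) (α⊆γ i))

  γδ-strip : StableHStrip γ δ
  γδ-strip =
    γ⊆δ , m , n , ℕₚ.≤-<-trans m≤r r<n
    , (λ i i<m → oneBox-fixes-infinite α γ γ-oneBox (α-top i i<m) +∞-infinite)
    , oneBox-IsFin α γ γ-oneBox (am , αm≡)
    , oneBox-fixes-infinite β δ δ-oneBox βm≡ +∞-infinite
    , oneBox-IsFin β δ δ-oneBox (bn , βn≡)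
    , (λ i n<i → oneBox-fixes-infinite β δ δ-oneBox (β-bottom i n<i) -∞-infinite)
    , oneBox-fixes-infinite α γ γ-oneBox αn≡ -∞-infinite
    , γδ-interlace

  N₀ : ℕ
  N₀ = suc ∣ am ∣ ℕ.⊔ ∣ bn ∣

  module Truncated {N : ℕ} (N₀≤N : N₀ ≤ N) where
    t : ℤ∞ → ℤ
    t = truncℤ∞ N

    1+am≤N : sucℤ am ℤ.≤ + N
    1+am≤N = ℤₚ.≤-trans (ℤₚ.suc-mono (proj₂ (-∣i∣≤i≤∣i∣ am)))
                        (+≤+ (ℕₚ.≤-trans (ℕₚ.m≤m⊔n (suc ∣ am ∣) ∣ bn ∣) N₀≤N))

    -N≤bn : - (+ N) ℤ.≤ bn
    -N≤bn = ℤₚ.≤-trans (ℤₚ.neg-mono-≤ (+≤+ (ℕₚ.≤-trans (ℕₚ.m≤n⊔m (suc ∣ am ∣) ∣ bn ∣) N₀≤N)))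
                       (proj₁ (-∣i∣≤i≤∣i∣ bn))

    β-lower : ∀ i → - (+ N) ℤ.≤ t (row β i)
    β-lower i = truncℤ∞-lower (λ βi → ℤₚ.≤-trans -N≤bn (β-finite-≥ βi))

    α-upper : ∀ i → t (row α i) ℤ.≤ + N
    α-upper i = truncℤ∞-upper (λ αi →
      ℤₚ.≤-trans (ℤₚ.≤-trans (α-finite-≤ αi) (ℤₚ.i≤suc[i] am)) 1+am≤N)

    slack : t (row α k) ℤ.< t (row β k)
    slack = subst (ℤ._< t (row β k)) (cong t (sym αk≡)) (ℤₚ.suc[i]≤j⇒i<j
      (truncℤ∞-mono c'≤βk (β-lower k)
        (ℤₚ.≤-trans (ℤₚ.suc-mono (α-finite-≤ αk≡)) 1+am≤N)))

    open BoxSlide (t ∘ row β) (t ∘ row δ) (t ∘ row (+∞ ∷ α)) (t ∘ row (+∞ ∷ γ)) (s≤s k≤r)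
      (λ j → truncℤ∞-mono (α⊆β j) (β-lower j) (α-upper j))
      slack
      (λ k<j j<1+r → cong t (full k<j (ℕₚ.≤-pred j<1+r)))
      (trans (cong t δbox≡) (trans (sym (sucℤ[i-1]≡i c)) (cong (sucℤ ∘ t) (sym βbox≡))))
      (cong t ∘ δ-other _)
      refl
      (trans (cong t γk≡) (cong (sucℤ ∘ t) (sym αk≡)))
      (cong t ∘ γ-other)
      using (localRuleℤ-boxSlide)

    hopscotch : ∀ L → suc (suc r) ≤ L → hopscotchCorner N L α β δ ≡ trunc N L (+∞ ∷ γ)
    hopscotch L L₀≤L
      rewrite trunc-applyUpTo N L β | trunc-applyUpTo N L δ
            | trunc-applyUpTo N L (+∞ ∷ α) | trunc-applyUpTo N L (+∞ ∷ γ)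
            = localRuleℤ-boxSlide L L₀≤L

theorem6p3 : (α β δ : Shape) (c : ℤ) →
    IsStableShape α → IsStableShape β → IsStableShape δ →
    StableHStrip α β → OneBox β δ c →
    Σ ℤ λ c' → ChosenColumn α β c c' ×
      Σ Shape λ γ →
        IsStableShape γ × α ⊆ γ × OneBox α γ c' ×
        γ ⊆ δ × StableHStrip γ δ ×
        Σ ℕ λ N₀ → Σ ℕ λ L₀ → ∀ N L → N₀ ≤ N → L₀ ≤ L →
          hopscotchCorner N L α β δ ≡ trunc N L (+∞ ∷ γ)
theorem6p3 α β δ c stα stβ stδ (α⊆β , _ , _ , _ , α-top , _ , βm≡ , _) (zero , β0≡ , _) =
  ⊥-elim (fin≢+∞ (trans (sym β0≡) (hstrip-top α β α⊆β α-top βm≡ z≤n)))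
theorem6p3 α β δ c stα stβ stδ
  (α⊆β , _ , _ , _ , α-top , (_ , αm≡) , βm≡ , (_ , βn≡) , β-bottom , αn≡ , interlace)
  (suc r , βbox≡ , δbox≡ , δ-other) =
  c' , chosen , γ , γ-stable , α⊆γ , γ-oneBox , γ⊆δ , γδ-strip , N₀ , suc (suc r) ,
  λ N L N₀≤N L₀≤L → Truncated.hopscotch N₀≤N L L₀≤L
  where
  open OneBoxHopscotch {α} {β} {δ} stα stβ stδ α⊆β α-top αm≡ βm≡ βn≡ β-bottom αn≡ interlace
                       βbox≡ δbox≡ δ-other
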